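{- For all integers $n\ge1$ and $m\in\mathbb{Z}$, \[ \sum_{l=0}^{n}(-1)^l\binom{n}{l}F_{n+1}^{(l+m-n+1)}=(-1)^n n!, \] \[ \sum_{l=1}^{n}(-1)^l\binom{n}{l}\,l\,\Bigl(F_{n+1}^{(lm)}-m^{n-1}F_{n+1}^{(l)}\Bigr)=\tfrac12(-1)^{n-1}m^{n-1}(1-m)\,n\,(n+1)!. \]
   Context: For $p\in\mathbb{Z}$, the generalized Fibonacci numbers $F_k^{(p)}$ are defined by $F_0^{(p)}=0$, $F_1^{(p)}=1$, $F_k^{(p)}=pF_{k-1}^{(p)}+F_{k-2}^{(p)}$ for $k\ge2$. The convention $0^0=1$ is used. -}

module Defs where

open import Data.Nat as ℕ using (ℕ; zero; suc)
open import Data.Integer using (ℤ; _+_; _*_; +_; -_)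

F : ℤ → ℕ → ℤ
F p zero = + 0
F p (suc zero) = + 1
F p (suc (suc k)) = p * F p (suc k) + F p k

sign : ℕ → ℤ
sign zero = + 1
sign (suc k) = - sign k

sumTo : ℕ → (ℕ → ℤ) → ℤ
sumTo zero f = f 0
sumTo (suc n) f = sumTo n f + f (suc n)

sumFrom1 : ℕ → (ℕ → ℤ) → ℤ
sumFrom1 zero f = + 0
sumFrom1 (suc n) f = sumFrom1 n f + f (suc n)

{-# OPTIONS --safe #-}
module Submission where

-- Let ∇ₙ g = Σₗ (-1)ˡ C(n,l) g(l) be the binomial transform. Pascal's rule gives ∇ₙ (l ↦ f (l + c)) = (-1)ⁿ Δⁿ f (c), and by
-- the recurrence x ↦ F_{k+1}^{(s x)} is a polynomial of degree k with leading coefficient sᵏ, so its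
-- k-th difference is the constant k! sᵏ; this is the first identity. For the second, the absorption
-- l C(n,l) = n C(n-1,l-1) turns the sum into -n (-1)ⁿ⁻¹ Δⁿ⁻¹ Q (1) with
-- Q y = F_{n+1}^{(m y)} - mⁿ⁻¹ F_{n+1}^{(y)}. Now Δⁿ⁻¹ Q is affine with slope n! (mⁿ - mⁿ⁻¹), and since
-- F_{n+1}^{(-p)} = (-1)ⁿ F_{n+1}^{(p)} it is odd about the point (1 - n)/2, so its value at 1 is
-- (n + 1)/2 times the slope.

open import Defs
open import Data.Nat as ℕ using (ℕ; zero; suc; z≤n; s≤s; _≥_; _∸_; _!)
import Data.Nat.Properties as ℕ
open import Data.Nat.Combinatorics
  using (_C_; nCk+nC[k+1]≡[n+1]C[k+1]; nC1≡n; nCk≡nC[n∸k]; k>n⇒nCk≡0)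
open import Data.Integer using (ℤ; _+_; _-_; _*_; _^_; +_; -_)
import Data.Integer.Properties as ℤ
open import Data.Product using (_×_; _,_; proj₁; proj₂)
open import Function using (const)
open import Relation.Binary.PropositionalEquality
  using (_≡_; refl; sym; trans; cong; cong₂; _≗_; module ≡-Reasoning)
open import Data.Integer.Tactic.RingSolver using (solve-∀)
import Data.Nat.Tactic.RingSolver as ℕ-Solver

sumTo-cong : ∀ n {f g : ℕ → ℤ} → (∀ l → l ℕ.≤ n → f l ≡ g l) → sumTo n f ≡ sumTo n g
sumTo-cong zero    eq = eq 0 z≤n
sumTo-cong (suc n) eq =
  cong₂ _+_ (sumTo-cong n (λ l l≤n → eq l (ℕ.m≤n⇒m≤1+n l≤n))) (eq (suc n) ℕ.≤-refl)

sumTo-- : ∀ n (f g : ℕ → ℤ) → sumTo n (λ l → f l - g l) ≡ sumTo n f - sumTo n g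
sumTo-- zero    f g = refl
sumTo-- (suc n) f g =
  trans (cong (_+ (f (suc n) - g (suc n))) (sumTo-- n f g)) (interchange (sumTo n f) (sumTo n g) (f (suc n)) (g (suc n)))
  where
  interchange : ∀ (a b c d : ℤ) → (a - b) + (c - d) ≡ (a + c) - (b + d)
  interchange = solve-∀

sumTo-*ˡ : ∀ n (a : ℤ) (f : ℕ → ℤ) → sumTo n (λ l → a * f l) ≡ a * sumTo n f
sumTo-*ˡ zero    a f = refl
sumTo-*ˡ (suc n) a f =
  trans (cong (_+ (a * f (suc n))) (sumTo-*ˡ n a f))
        (sym (ℤ.*-distribˡ-+ a (sumTo n f) (f (suc n))))

sumTo-suc : ∀ n (f : ℕ → ℤ) → sumTo (suc n) f ≡ f 0 + sumTo n (λ l → f (suc l))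
sumTo-suc zero    f = refl
sumTo-suc (suc n) f =
  trans (cong (_+ f (suc (suc n))) (sumTo-suc n f)) (ℤ.+-assoc (f 0) _ _)

sumTo-reverse : ∀ n (f : ℕ → ℤ) → sumTo n f ≡ sumTo n (λ l → f (n ∸ l))
sumTo-reverse zero    f = refl
sumTo-reverse (suc n) f = begin
    sumTo (suc n) f
  ≡⟨ sumTo-suc n f ⟩
    f 0 + sumTo n (λ l → f (suc l))
  ≡⟨ cong (λ s → f 0 + s) (sumTo-reverse n (λ l → f (suc l))) ⟩
    f 0 + sumTo n (λ l → f (suc (n ∸ l)))
  ≡⟨ cong (λ s → f 0 + s) (sumTo-cong n (λ l l≤n → cong f (sym (ℕ.+-∸-assoc 1 l≤n)))) ⟩
    f 0 + sumTo n (λ l → f (suc n ∸ l))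
  ≡⟨ ℤ.+-comm (f 0) _ ⟩
    sumTo n (λ l → f (suc n ∸ l)) + f 0
  ≡⟨ cong (λ k → sumTo n (λ l → f (suc n ∸ l)) + f k) (sym (ℕ.n∸n≡0 n)) ⟩
    sumTo (suc n) (λ l → f (suc n ∸ l))
  ∎
  where open ≡-Reasoning

sumFrom1-suc : ∀ n (f : ℕ → ℤ) → sumFrom1 (suc n) f ≡ sumTo n (λ l → f (suc l))
sumFrom1-suc zero    f = ℤ.+-identityˡ (f 1)
sumFrom1-suc (suc n) f = cong (_+ f (suc (suc n))) (sumFrom1-suc n f)

sign-+ : ∀ a b → sign (a ℕ.+ b) ≡ sign a * sign b
sign-+ zero    b = sym (ℤ.*-identityˡ _)
sign-+ (suc a) b = trans (cong -_ (sign-+ a b)) (ℤ.neg-distribˡ-* (sign a) (sign b))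

sign*sign≡1 : ∀ a → sign a * sign a ≡ + 1
sign*sign≡1 zero    = refl
sign*sign≡1 (suc a) = trans (square-neg (sign a)) (sign*sign≡1 a)
  where
  square-neg : ∀ (s : ℤ) → (- s) * (- s) ≡ s * s
  square-neg = solve-∀

sign-*-cancelˡ : ∀ a {x y : ℤ} → sign a * x ≡ sign a * y → x ≡ y
sign-*-cancelˡ a {x} {y} eq = begin
    x                    ≡⟨ sym (ℤ.*-identityˡ x) ⟩
    + 1 * x              ≡⟨ cong (_* x) (sym (sign*sign≡1 a)) ⟩
    sign a * sign a * x  ≡⟨ ℤ.*-assoc (sign a) _ x ⟩
    sign a * (sign a * x) ≡⟨ cong (sign a *_) eq ⟩
    sign a * (sign a * y) ≡⟨ sym (ℤ.*-assoc (sign a) _ y) ⟩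
    sign a * sign a * y  ≡⟨ cong (_* y) (sign*sign≡1 a) ⟩
    + 1 * y              ≡⟨ ℤ.*-identityˡ y ⟩
    y                    ∎
  where open ≡-Reasoning

sign-∸ : ∀ {k l} → l ℕ.≤ k → sign (k ∸ l) ≡ sign k * sign l
sign-∸ {k} {l} l≤k = begin
    sign (k ∸ l)                     ≡⟨ sym (ℤ.*-identityʳ _) ⟩
    sign (k ∸ l) * + 1               ≡⟨ cong (sign (k ∸ l) *_) (sym (sign*sign≡1 l)) ⟩
    sign (k ∸ l) * (sign l * sign l) ≡⟨ sym (ℤ.*-assoc (sign (k ∸ l)) _ _) ⟩
    sign (k ∸ l) * sign l * sign l   ≡⟨ cong (_* sign l) (sym (sign-+ (k ∸ l) l)) ⟩
    sign (k ∸ l ℕ.+ l) * sign l      ≡⟨ cong (λ j → sign j * sign l) (ℕ.m∸n+n≡m l≤k) ⟩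
    sign k * sign l                  ∎
  where open ≡-Reasoning

[k+1]*[n+1]C[k+1]≡[n+1]*nCk : ∀ n k → suc k ℕ.* (suc n C suc k) ≡ suc n ℕ.* (n C k)
[k+1]*[n+1]C[k+1]≡[n+1]*nCk zero    zero    = refl
[k+1]*[n+1]C[k+1]≡[n+1]*nCk zero    (suc k) = ℕ.*-zeroʳ (suc (suc k))
[k+1]*[n+1]C[k+1]≡[n+1]*nCk (suc n) zero    =
  trans (ℕ.+-identityʳ _) (trans (nC1≡n (suc (suc n))) (sym (ℕ.*-identityʳ _)))
[k+1]*[n+1]C[k+1]≡[n+1]*nCk (suc n) (suc k) = begin
    suc (suc k) ℕ.* (suc (suc n) C suc (suc k))
  ≡⟨ cong (suc (suc k) ℕ.*_) (sym (nCk+nC[k+1]≡[n+1]C[k+1] (suc n) (suc k))) ⟩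
    suc (suc k) ℕ.* (A ℕ.+ B)
  ≡⟨ expand k A B ⟩
    suc k ℕ.* A ℕ.+ A ℕ.+ suc (suc k) ℕ.* B
  ≡⟨ cong₂ (λ u v → u ℕ.+ A ℕ.+ v)
       ([k+1]*[n+1]C[k+1]≡[n+1]*nCk n k) ([k+1]*[n+1]C[k+1]≡[n+1]*nCk n (suc k)) ⟩
    suc n ℕ.* (n C k) ℕ.+ A ℕ.+ suc n ℕ.* (n C suc k)
  ≡⟨ collect n (n C k) (n C suc k) A ⟩
    suc n ℕ.* (n C k ℕ.+ n C suc k) ℕ.+ A
  ≡⟨ cong (λ j → suc n ℕ.* j ℕ.+ A) (nCk+nC[k+1]≡[n+1]C[k+1] n k) ⟩
    suc n ℕ.* A ℕ.+ A
  ≡⟨ ℕ.+-comm (suc n ℕ.* A) A ⟩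
    suc (suc n) ℕ.* A
  ∎
  where
  open ≡-Reasoning
  A = suc n C suc k
  B = suc n C suc (suc k)
  expand : ∀ k A B → suc (suc k) ℕ.* (A ℕ.+ B) ≡ suc k ℕ.* A ℕ.+ A ℕ.+ suc (suc k) ℕ.* B
  expand = ℕ-Solver.solve-∀
  collect : ∀ n a b A → suc n ℕ.* a ℕ.+ A ℕ.+ suc n ℕ.* b ≡ suc n ℕ.* (a ℕ.+ b) ℕ.+ A
  collect = ℕ-Solver.solve-∀

binomialTransform : ℕ → (ℕ → ℤ) → ℤ
binomialTransform n g = sumTo n (λ l → sign l * + (n C l) * g l)

binomialTransform-cong : ∀ n {f g : ℕ → ℤ} → (∀ l → l ℕ.≤ n → f l ≡ g l) →
                         binomialTransform n f ≡ binomialTransform n g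
binomialTransform-cong n eq = sumTo-cong n (λ l l≤n → cong (sign l * + (n C l) *_) (eq l l≤n))

binomialTransform-*ˡ : ∀ n (a : ℤ) (g : ℕ → ℤ) →
                       binomialTransform n (λ l → a * g l) ≡ a * binomialTransform n g
binomialTransform-*ˡ n a g =
  trans (sumTo-cong n (λ l _ → pull a (sign l) (+ (n C l)) (g l))) (sumTo-*ˡ n a _)
  where
  pull : ∀ (a s c x : ℤ) → s * c * (a * x) ≡ a * (s * c * x)
  pull = solve-∀

binomialTransform-suc : ∀ n (g : ℕ → ℤ) →
  binomialTransform (suc n) g ≡ binomialTransform n g - binomialTransform n (λ l → g (suc l))
binomialTransform-suc n g = begin
    binomialTransform (suc n) g
  ≡⟨ sumTo-suc n _ ⟩
    t g 0 + sumTo n (λ l → sign (suc l) * + (suc n C suc l) * g (suc l))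
  ≡⟨ cong (λ s → t g 0 + s) (sumTo-cong n (λ l _ → pascal l)) ⟩
    t g 0 + sumTo n (λ l → t g (suc l) - t (λ j → g (suc j)) l)
  ≡⟨ cong (λ s → t g 0 + s) (sumTo-- n _ _) ⟩
    t g 0 + (sumTo n (λ l → t g (suc l)) - binomialTransform n (λ l → g (suc l)))
  ≡⟨ sym (ℤ.+-assoc (t g 0) _ _) ⟩
    t g 0 + sumTo n (λ l → t g (suc l)) - binomialTransform n (λ l → g (suc l))
  ≡⟨ cong (_- binomialTransform n (λ l → g (suc l))) (trans (sym (sumTo-suc n (t g))) top-vanishes) ⟩
    binomialTransform n g - binomialTransform n (λ l → g (suc l))
  ∎
  where
  open ≡-Reasoning
  t : (ℕ → ℤ) → ℕ → ℤ
  t f l = sign l * + (n C l) * f l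
  split : ∀ (s a b x : ℤ) → (- s) * (a + b) * x ≡ (- s) * b * x - s * a * x
  split = solve-∀
  pascal : ∀ l → sign (suc l) * + (suc n C suc l) * g (suc l) ≡ t g (suc l) - t (λ j → g (suc j)) l
  pascal l = trans
    (cong (λ c → sign (suc l) * c * g (suc l))
          (trans (cong +_ (sym (nCk+nC[k+1]≡[n+1]C[k+1] n l))) (ℤ.pos-+ (n C l) _)))
    (split (sign l) (+ (n C l)) _ (g (suc l)))
  top-vanishes : sumTo (suc n) (t g) ≡ binomialTransform n g
  top-vanishes = begin
      sumTo n (t g) + sign (suc n) * + (n C suc n) * g (suc n)
    ≡⟨ cong (λ c → sumTo n (t g) + sign (suc n) * + c * g (suc n)) (k>n⇒nCk≡0 (ℕ.n<1+n n)) ⟩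
      sumTo n (t g) + sign (suc n) * + 0 * g (suc n)
    ≡⟨ cong (λ c → sumTo n (t g) + c * g (suc n)) (ℤ.*-zeroʳ (sign (suc n))) ⟩
      sumTo n (t g) + + 0
    ≡⟨ ℤ.+-identityʳ _ ⟩
      binomialTransform n g
    ∎

binomialTransform-reverse : ∀ k (g : ℕ → ℤ) →
  binomialTransform k g ≡ sign k * binomialTransform k (λ l → g (k ∸ l))
binomialTransform-reverse k g = begin
    binomialTransform k g
  ≡⟨ sumTo-reverse k _ ⟩
    sumTo k (λ l → sign (k ∸ l) * + (k C (k ∸ l)) * g (k ∸ l))
  ≡⟨ sumTo-cong k (λ l l≤k → trans
       (cong₂ (λ s c → s * + c * g (k ∸ l)) (sign-∸ l≤k) (sym (nCk≡nC[n∸k] l≤k)))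
       (reassoc (sign k) (sign l) _ _)) ⟩
    sumTo k (λ l → sign k * (sign l * + (k C l) * g (k ∸ l)))
  ≡⟨ sumTo-*ˡ k (sign k) _ ⟩
    sign k * binomialTransform k (λ l → g (k ∸ l))
  ∎
  where
  open ≡-Reasoning
  reassoc : ∀ (s s′ c x : ℤ) → s * s′ * c * x ≡ s * (s′ * c * x)
  reassoc = solve-∀

Δ : (ℤ → ℤ) → ℤ → ℤ
Δ f x = f (x + + 1) - f x

Δ^ : ℕ → (ℤ → ℤ) → ℤ → ℤ
Δ^ zero    f = f
Δ^ (suc d) f = Δ^ d (Δ f)

Δ^-cong : ∀ d {f g : ℤ → ℤ} → f ≗ g → Δ^ d f ≗ Δ^ d g
Δ^-cong zero    f≗g = f≗g
Δ^-cong (suc d) f≗g = Δ^-cong d (λ y → cong₂ _-_ (f≗g (y + + 1)) (f≗g y))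

Δ^-linear : ∀ d (a b : ℤ) (f g : ℤ → ℤ) →
            Δ^ d (λ y → a * f y + b * g y) ≗ (λ x → a * Δ^ d f x + b * Δ^ d g x)
Δ^-linear zero    a b f g x = refl
Δ^-linear (suc d) a b f g x =
  trans (Δ^-cong d (λ y → regroup a b (f (y + + 1)) (g (y + + 1)) (f y) (g y)) x)
        (Δ^-linear d a b (Δ f) (Δ g) x)
  where
  regroup : ∀ (a b f₁ g₁ f₀ g₀ : ℤ) →
            (a * f₁ + b * g₁) - (a * f₀ + b * g₀) ≡ a * (f₁ - f₀) + b * (g₁ - g₀)
  regroup = solve-∀

Δ^-translate : ∀ d (c : ℤ) (f : ℤ → ℤ) → Δ^ d (λ y → f (y + c)) ≗ (λ x → Δ^ d f (x + c))
Δ^-translate zero    c f x = refl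
Δ^-translate (suc d) c f x =
  trans (Δ^-cong d (λ y → cong (λ z → f z - f (y + c)) (swap y c)) x)
        (Δ^-translate d c (Δ f) x)
  where
  swap : ∀ (y c : ℤ) → y + + 1 + c ≡ y + c + + 1
  swap = solve-∀

Δ^-suc : ∀ d (f : ℤ → ℤ) x → Δ^ (suc d) f x ≡ Δ^ d f (x + + 1) - Δ^ d f x
Δ^-suc d f x = begin
    Δ^ d (Δ f) x
  ≡⟨ Δ^-cong d (λ y → as-combination (f (y + + 1)) (f y)) x ⟩
    Δ^ d (λ y → + 1 * f (y + + 1) + (- + 1) * f y) x
  ≡⟨ Δ^-linear d (+ 1) (- + 1) (λ y → f (y + + 1)) f x ⟩
    + 1 * Δ^ d (λ y → f (y + + 1)) x + (- + 1) * Δ^ d f x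
  ≡⟨ cong (λ z → + 1 * z + (- + 1) * Δ^ d f x) (Δ^-translate d (+ 1) f x) ⟩
    + 1 * Δ^ d f (x + + 1) + (- + 1) * Δ^ d f x
  ≡⟨ sym (as-combination (Δ^ d f (x + + 1)) (Δ^ d f x)) ⟩
    Δ^ d f (x + + 1) - Δ^ d f x
  ∎
  where
  open ≡-Reasoning
  as-combination : ∀ (u v : ℤ) → u - v ≡ + 1 * u + (- + 1) * v
  as-combination = solve-∀

binomialTransform-Δ^ : ∀ n (f : ℤ → ℤ) c →
                       binomialTransform n (λ l → f (+ l + c)) ≡ sign n * Δ^ n f c
binomialTransform-Δ^ zero    f c =
  trans (ℤ.*-identityˡ _) (trans (cong f (ℤ.+-identityˡ c)) (sym (ℤ.*-identityˡ _)))
binomialTransform-Δ^ (suc n) f c = begin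
    binomialTransform (suc n) (λ l → f (+ l + c))
  ≡⟨ binomialTransform-suc n _ ⟩
    binomialTransform n (λ l → f (+ l + c)) - binomialTransform n (λ l → f (+ suc l + c))
  ≡⟨ cong (λ z → binomialTransform n (λ l → f (+ l + c)) - z)
          (binomialTransform-cong n (λ l _ → cong f (shift (+ l) c))) ⟩
    binomialTransform n (λ l → f (+ l + c)) - binomialTransform n (λ l → f (+ l + (c + + 1)))
  ≡⟨ cong₂ _-_ (binomialTransform-Δ^ n f c) (binomialTransform-Δ^ n f (c + + 1)) ⟩
    sign n * Δ^ n f c - sign n * Δ^ n f (c + + 1)
  ≡⟨ factor (sign n) _ _ ⟩
    - sign n * (Δ^ n f (c + + 1) - Δ^ n f c)
  ≡⟨ cong (- sign n *_) (sym (Δ^-suc n f c)) ⟩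
    sign (suc n) * Δ^ (suc n) f c
  ∎
  where
  open ≡-Reasoning
  shift : ∀ (l c : ℤ) → (+ 1 + l) + c ≡ l + (c + + 1)
  shift = solve-∀
  factor : ∀ (s u v : ℤ) → s * u - s * v ≡ - s * (v - u)
  factor = solve-∀

Δ^-suc-const : ∀ d (a : ℤ) (f : ℤ → ℤ) → Δ^ d f ≗ const a → Δ^ (suc d) f ≗ const (+ 0)
Δ^-suc-const d a f Δ^f≗a x =
  trans (Δ^-suc d f x) (trans (cong₂ _-_ (Δ^f≗a (x + + 1)) (Δ^f≗a x)) (ℤ.+-inverseʳ a))

Δ^-*id : ∀ d (a : ℤ) (f : ℤ → ℤ) → Δ^ d f ≗ const a →
         Δ^ (suc d) (λ x → x * f x) ≗ const (+ suc d * a)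
Δ^-*id d a f Δ^f≗a x = begin
    Δ^ d (Δ (λ y → y * f y)) x
  ≡⟨ Δ^-cong d (λ y → product-rule y (f (y + + 1)) (f y)) x ⟩
    Δ^ d (λ y → + 1 * (y * Δ f y) + + 1 * f (y + + 1)) x
  ≡⟨ Δ^-linear d (+ 1) (+ 1) (λ y → y * Δ f y) (λ y → f (y + + 1)) x ⟩
    + 1 * Δ^ d (λ y → y * Δ f y) x + + 1 * Δ^ d (λ y → f (y + + 1)) x
  ≡⟨ cong₂ (λ u v → + 1 * u + + 1 * v)
           (Δ^-*Δ d f Δ^f≗a) (trans (Δ^-translate d (+ 1) f x) (Δ^f≗a (x + + 1))) ⟩
    + 1 * (+ d * a) + + 1 * a
  ≡⟨ collect (+ d) a ⟩
    + suc d * a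
  ∎
  where
  open ≡-Reasoning
  product-rule : ∀ (y u v : ℤ) → (y + + 1) * u - y * v ≡ + 1 * (y * (u - v)) + + 1 * u
  product-rule = solve-∀
  collect : ∀ (d a : ℤ) → + 1 * (d * a) + + 1 * a ≡ (+ 1 + d) * a
  collect = solve-∀
  vanish : ∀ (x a : ℤ) → x * (a - a) ≡ + 0 * a
  vanish = solve-∀
  Δ^-*Δ : ∀ d (f : ℤ → ℤ) → Δ^ d f ≗ const a → Δ^ d (λ y → y * Δ f y) x ≡ + d * a
  Δ^-*Δ zero    f f≗a   = trans (cong (λ z → x * z) (cong₂ _-_ (f≗a (x + + 1)) (f≗a x))) (vanish x a)
  Δ^-*Δ (suc d) f Δ^f≗a   = Δ^-*id d a (Δ f) Δ^f≗a x

Δ^-progression : ∀ d (a : ℤ) (f : ℤ → ℤ) → Δ^ (suc d) f ≗ const a →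
                 ∀ j x → Δ^ d f (x + + j) ≡ Δ^ d f x + + j * a
Δ^-progression d a f Δ^f≗a zero x =
  trans (cong (Δ^ d f) (ℤ.+-identityʳ x)) (sym (ℤ.+-identityʳ (Δ^ d f x)))
Δ^-progression d a f Δ^f≗a (suc j) x = begin
    Δ^ d f (x + + suc j)
  ≡⟨ cong (Δ^ d f) (assoc x (+ j)) ⟩
    Δ^ d f (x + + j + + 1)
  ≡⟨ step (x + + j) ⟩
    Δ^ d f (x + + j) + a
  ≡⟨ cong (_+ a) (Δ^-progression d a f Δ^f≗a j x) ⟩
    Δ^ d f x + + j * a + a
  ≡⟨ collect (Δ^ d f x) (+ j) a ⟩
    Δ^ d f x + + suc j * a
  ∎
  where
  open ≡-Reasoning
  assoc : ∀ (x j : ℤ) → x + (+ 1 + j) ≡ x + j + + 1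
  assoc = solve-∀
  collect : ∀ (u j a : ℤ) → u + j * a + a ≡ u + (+ 1 + j) * a
  collect = solve-∀
  move : ∀ (u v : ℤ) → v - u ≡ a → v ≡ u + a
  move u v eq = trans (sym (cancel u v)) (cong (λ z → u + z) eq)
    where
    cancel : ∀ (u v : ℤ) → u + (v - u) ≡ v
    cancel = solve-∀
  step : ∀ y → Δ^ d f (y + + 1) ≡ Δ^ d f y + a
  step y = move _ _ (trans (sym (Δ^-suc d f y)) (Δ^f≗a y))

Δ^-reflect : ∀ k (g : ℤ → ℤ) (ε c : ℤ) → (∀ y → g (- y) ≡ ε * g y) →
             sign k * Δ^ k g c ≡ ε * Δ^ k g (- (c + + k))
Δ^-reflect k g ε c parity = begin
    sign k * Δ^ k g c
  ≡⟨ sym (binomialTransform-Δ^ k g c) ⟩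
    binomialTransform k (λ l → g (+ l + c))
  ≡⟨ binomialTransform-reverse k _ ⟩
    sign k * binomialTransform k (λ l → g (+ (k ∸ l) + c))
  ≡⟨ cong (sign k *_) (binomialTransform-cong k mirror) ⟩
    sign k * binomialTransform k (λ l → ε * g (+ l + c′))
  ≡⟨ cong (sign k *_) (binomialTransform-*ˡ k ε _) ⟩
    sign k * (ε * binomialTransform k (λ l → g (+ l + c′)))
  ≡⟨ cong (λ z → sign k * (ε * z)) (binomialTransform-Δ^ k g c′) ⟩
    sign k * (ε * (sign k * Δ^ k g c′))
  ≡⟨ gather (sign k) ε (Δ^ k g c′) ⟩
    sign k * sign k * (ε * Δ^ k g c′)
  ≡⟨ cong (_* (ε * Δ^ k g c′)) (sign*sign≡1 k) ⟩
    + 1 * (ε * Δ^ k g c′)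
  ≡⟨ ℤ.*-identityˡ _ ⟩
    ε * Δ^ k g c′
  ∎
  where
  open ≡-Reasoning
  c′ : ℤ
  c′ = - (c + + k)
  negate : ∀ (u l c : ℤ) → u + c ≡ - (l + - (c + (u + l)))
  negate = solve-∀
  gather : ∀ (s ε x : ℤ) → s * (ε * (s * x)) ≡ s * s * (ε * x)
  gather = solve-∀
  mirror : ∀ l → l ℕ.≤ k → g (+ (k ∸ l) + c) ≡ ε * g (+ l + c′)
  mirror l l≤k = trans (cong g (trans (negate (+ (k ∸ l)) (+ l) c) (cong (λ z → - (+ l + - (c + z))) k∸l+l≡k)))
                       (parity (+ l + c′))
    where
    k∸l+l≡k : + (k ∸ l) + + l ≡ + k
    k∸l+l≡k = trans (sym (ℤ.pos-+ (k ∸ l) l)) (cong +_ (ℕ.m∸n+n≡m l≤k))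

-- Δᵏ g is affine with slope a, and odd about -k/2 by Δ^-reflect.
twice-Δ^-at-1 : ∀ k (a : ℤ) (g : ℤ → ℤ) → Δ^ (suc k) g ≗ const a →
                (∀ y → g (- y) ≡ sign (suc k) * g y) →
                + 2 * Δ^ k g (+ 1) ≡ + suc (suc k) * a
twice-Δ^-at-1 k a g Δ^g≗a parity = begin
    + 2 * X          ≡⟨ double X ⟩
    X + X            ≡⟨ cong₂ _+_ X≡-Y X≡Y+[k+2]a ⟩
    - Y + (Y + A)    ≡⟨ cancel Y A ⟩
    A                ∎
  where
  open ≡-Reasoning
  X Y A : ℤ
  X = Δ^ k g (+ 1)
  Y = Δ^ k g (- (+ 1 + + k))
  A = + suc (suc k) * a
  double : ∀ (x : ℤ) → + 2 * x ≡ x + x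
  double = solve-∀
  cancel : ∀ (y z : ℤ) → - y + (y + z) ≡ z
  cancel = solve-∀
  one : ∀ (k : ℤ) → + 1 ≡ - (+ 1 + k) + (+ 2 + k)
  one = solve-∀
  X≡-Y : X ≡ - Y
  X≡-Y = sign-*-cancelˡ k (begin
      sign k * X        ≡⟨ Δ^-reflect k g (sign (suc k)) (+ 1) parity ⟩
      - sign k * Y      ≡⟨ sym (ℤ.neg-distribˡ-* (sign k) Y) ⟩
      - (sign k * Y)    ≡⟨ ℤ.neg-distribʳ-* (sign k) Y ⟩
      sign k * - Y      ∎)
  X≡Y+[k+2]a : X ≡ Y + A
  X≡Y+[k+2]a = trans (cong (Δ^ k g) (one (+ k)))
                     (Δ^-progression k a g Δ^g≗a (suc (suc k)) (- (+ 1 + + k)))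

F-neg : ∀ (p : ℤ) j → F (- p) j ≡ sign (suc j) * F p j
F-neg p zero          = refl
F-neg p (suc zero)    = refl
F-neg p (suc (suc j)) =
  trans (cong₂ (λ u v → - p * u + v) (F-neg p (suc j)) (F-neg p j))
        (recurrence p (sign j) (F p (suc j)) (F p j))
  where
  recurrence : ∀ (p s u v : ℤ) → - p * (- - s * u) + - s * v ≡ - - - s * (p * u + v)
  recurrence = solve-∀

Δ^-F : ∀ (s : ℤ) k → Δ^ k (λ x → F (s * x) (suc k)) ≗ const (+ (k !) * s ^ k)
                   × Δ^ (suc k) (λ x → F (s * x) k) ≗ const (+ 0)
Δ^-F s zero    = (λ x → refl) , (λ x → refl)
Δ^-F s (suc k) = Δ^Fₖ₊₂ , Δ^-suc-const (suc k) (+ 0) Fₖ₊₁ (Δ^-suc-const k _ Fₖ₊₁ Δ^Fₖ₊₁)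
  where
  open ≡-Reasoning
  Fₖ₊₁ : ℤ → ℤ
  Fₖ₊₁ x = F (s * x) (suc k)
  Δ^Fₖ₊₁ : Δ^ k Fₖ₊₁ ≗ const (+ (k !) * s ^ k)
  Δ^Fₖ₊₁ = proj₁ (Δ^-F s k)
  Δ^Fₖ : Δ^ (suc k) (λ x → F (s * x) k) ≗ const (+ 0)
  Δ^Fₖ = proj₂ (Δ^-F s k)
  recurrence : ∀ (s y u v : ℤ) → s * y * u + v ≡ s * (y * u) + + 1 * v
  recurrence = solve-∀
  leading : ∀ (s d k! sᵏ : ℤ) → s * (d * (k! * sᵏ)) + + 1 * + 0 ≡ d * k! * (s * sᵏ)
  leading = solve-∀
  Δ^Fₖ₊₂ : Δ^ (suc k) (λ x → F (s * x) (suc (suc k))) ≗ const (+ (suc k !) * s ^ suc k)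
  Δ^Fₖ₊₂ x = begin
      Δ^ (suc k) (λ y → F (s * y) (suc (suc k))) x
    ≡⟨ Δ^-cong (suc k) (λ y → recurrence s y (F (s * y) (suc k)) (F (s * y) k)) x ⟩
      Δ^ (suc k) (λ y → s * (y * F (s * y) (suc k)) + + 1 * F (s * y) k) x
    ≡⟨ Δ^-linear (suc k) s (+ 1) _ _ x ⟩
      s * Δ^ (suc k) (λ y → y * F (s * y) (suc k)) x + + 1 * Δ^ (suc k) (λ y → F (s * y) k) x
    ≡⟨ cong₂ (λ u v → s * u + + 1 * v) (Δ^-*id k _ _ Δ^Fₖ₊₁ x) (Δ^Fₖ x) ⟩
      s * (+ suc k * (+ (k !) * s ^ k)) + + 1 * + 0
    ≡⟨ leading s (+ suc k) (+ (k !)) (s ^ k) ⟩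
      + suc k * + (k !) * (s * s ^ k)
    ≡⟨ cong (_* (s * s ^ k)) (sym (ℤ.pos-* (suc k) (k !))) ⟩
      + (suc k !) * s ^ suc k
    ∎

first-identity : ∀ n (m : ℤ) →
  binomialTransform n (λ l → F (+ l + m - + n + + 1) (suc n)) ≡ sign n * + (n !)
first-identity n m = begin
    binomialTransform n (λ l → F (+ l + m - + n + + 1) (suc n))
  ≡⟨ binomialTransform-cong n (λ l _ → cong (λ z → F z (suc n)) (regroup (+ l) m (+ n))) ⟩
    binomialTransform n (λ l → F (+ 1 * (+ l + c)) (suc n))
  ≡⟨ binomialTransform-Δ^ n (λ x → F (+ 1 * x) (suc n)) c ⟩
    sign n * Δ^ n (λ x → F (+ 1 * x) (suc n)) c
  ≡⟨ cong (sign n *_) (proj₁ (Δ^-F (+ 1) n) c) ⟩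
    sign n * (+ (n !) * (+ 1) ^ n)
  ≡⟨ cong (λ z → sign n * (+ (n !) * z)) (ℤ.^-zeroˡ n) ⟩
    sign n * (+ (n !) * + 1)
  ≡⟨ cong (sign n *_) (ℤ.*-identityʳ _) ⟩
    sign n * + (n !)
  ∎
  where
  open ≡-Reasoning
  c : ℤ
  c = m - + n + + 1
  regroup : ∀ (l m n : ℤ) → l + m - n + + 1 ≡ + 1 * (l + (m - n + + 1))
  regroup = solve-∀

sumFrom1-absorption : ∀ k (h : ℕ → ℤ) →
  sumFrom1 (suc k) (λ l → sign l * + (suc k C l) * + l * h l)
    ≡ - + suc k * binomialTransform k (λ j → h (suc j))
sumFrom1-absorption k h =
  trans (sumFrom1-suc k _) (trans (sumTo-cong k (λ j _ → absorb j)) (sumTo-*ˡ k (- + suc k) _))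
  where
  open ≡-Reasoning
  swap : ∀ (s c l x : ℤ) → - s * c * l * x ≡ - s * (l * c) * x
  swap = solve-∀
  extract : ∀ (s n c x : ℤ) → - s * (n * c) * x ≡ - n * (s * c * x)
  extract = solve-∀
  absorb : ∀ j → sign (suc j) * + (suc k C suc j) * + suc j * h (suc j)
                 ≡ - + suc k * (sign j * + (k C j) * h (suc j))
  absorb j = begin
      - sign j * + (suc k C suc j) * + suc j * h (suc j)
    ≡⟨ swap (sign j) _ _ _ ⟩
      - sign j * (+ suc j * + (suc k C suc j)) * h (suc j)
    ≡⟨ cong (λ c → - sign j * c * h (suc j)) (trans (sym (ℤ.pos-* (suc j) _))
         (trans (cong +_ ([k+1]*[n+1]C[k+1]≡[n+1]*nCk k j)) (ℤ.pos-* (suc k) (k C j)))) ⟩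
      - sign j * (+ suc k * + (k C j)) * h (suc j)
    ≡⟨ extract (sign j) (+ suc k) _ _ ⟩
      - + suc k * (sign j * + (k C j) * h (suc j))
    ∎

scalingDefect : ℤ → ℕ → ℤ → ℤ
scalingDefect m n y = F (y * m) (suc n) - m ^ (n ∸ 1) * F y (suc n)

Δ^-scalingDefect : ∀ (m : ℤ) k →
  Δ^ (suc k) (scalingDefect m (suc k)) ≗ const (+ (suc k !) * (m ^ suc k - m ^ k))
Δ^-scalingDefect m k x = begin
    Δ^ n (scalingDefect m n) x
  ≡⟨ Δ^-cong n split x ⟩
    Δ^ n (λ y → + 1 * Fₘ y + - m ^ k * F₁ y) x
  ≡⟨ Δ^-linear n (+ 1) (- m ^ k) Fₘ F₁ x ⟩
    + 1 * Δ^ n Fₘ x + - m ^ k * Δ^ n F₁ x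
  ≡⟨ cong₂ (λ u v → + 1 * u + - m ^ k * v) (proj₁ (Δ^-F m n) x) (proj₁ (Δ^-F (+ 1) n) x) ⟩
    + 1 * (+ (n !) * m ^ n) + - m ^ k * (+ (n !) * (+ 1) ^ n)
  ≡⟨ cong (λ z → + 1 * (+ (n !) * m ^ n) + - m ^ k * (+ (n !) * z)) (ℤ.^-zeroˡ n) ⟩
    + 1 * (+ (n !) * m ^ n) + - m ^ k * (+ (n !) * + 1)
  ≡⟨ leading (+ (n !)) (m ^ n) (m ^ k) ⟩
    + (n !) * (m ^ n - m ^ k)
  ∎
  where
  open ≡-Reasoning
  n : ℕ
  n = suc k
  Fₘ F₁ : ℤ → ℤ
  Fₘ y = F (m * y) (suc n)
  F₁ y = F (+ 1 * y) (suc n)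
  combination : ∀ (u mᵏ v : ℤ) → u - mᵏ * v ≡ + 1 * u + - mᵏ * v
  combination = solve-∀
  leading : ∀ (n! mⁿ mᵏ : ℤ) → + 1 * (n! * mⁿ) + - mᵏ * (n! * + 1) ≡ n! * (mⁿ - mᵏ)
  leading = solve-∀
  split : ∀ y → scalingDefect m n y ≡ + 1 * Fₘ y + - m ^ k * F₁ y
  split y = trans (cong₂ (λ u v → F u (suc n) - m ^ k * F v (suc n)) (ℤ.*-comm y m) (sym (ℤ.*-identityˡ y)))
                  (combination (Fₘ y) (m ^ k) (F₁ y))

scalingDefect-neg : ∀ (m : ℤ) n y → scalingDefect m n (- y) ≡ sign n * scalingDefect m n y
scalingDefect-neg m n y = begin
    F (- y * m) (suc n) - mⁿ⁻¹ * F (- y) (suc n)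
  ≡⟨ cong (λ z → F z (suc n) - mⁿ⁻¹ * F (- y) (suc n)) (sym (ℤ.neg-distribˡ-* y m)) ⟩
    F (- (y * m)) (suc n) - mⁿ⁻¹ * F (- y) (suc n)
  ≡⟨ cong₂ (λ u v → u - mⁿ⁻¹ * v) (F-neg (y * m) (suc n)) (F-neg y (suc n)) ⟩
    - - sign n * F (y * m) (suc n) - mⁿ⁻¹ * (- - sign n * F y (suc n))
  ≡⟨ factor (- - sign n) _ mⁿ⁻¹ _ ⟩
    - - sign n * scalingDefect m n y
  ≡⟨ cong (_* scalingDefect m n y) (ℤ.neg-involutive (sign n)) ⟩
    sign n * scalingDefect m n y
  ∎
  where
  open ≡-Reasoning
  mⁿ⁻¹ : ℤ
  mⁿ⁻¹ = m ^ (n ∸ 1)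
  factor : ∀ (σ u c v : ℤ) → σ * u - c * (σ * v) ≡ σ * (u - c * v)
  factor = solve-∀

second-identity : ∀ k (m : ℤ) →
  + 2 * sumFrom1 (suc k) (λ l → sign l * + (suc k C l) * + l * scalingDefect m (suc k) (+ l))
    ≡ sign k * m ^ k * (+ 1 - m) * + suc k * + (suc (suc k) !)
second-identity k m = begin
    + 2 * sumFrom1 n (λ l → sign l * + (n C l) * + l * Q (+ l))
  ≡⟨ cong (+ 2 *_) (sumFrom1-absorption k (λ l → Q (+ l))) ⟩
    + 2 * (- + n * binomialTransform k (λ j → Q (+ suc j)))
  ≡⟨ cong (λ z → + 2 * (- + n * z))
          (trans (binomialTransform-cong k (λ j _ → cong Q (ℤ.+-comm (+ 1) (+ j))))
                 (binomialTransform-Δ^ k Q (+ 1))) ⟩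
    + 2 * (- + n * (sign k * Δ^ k Q (+ 1)))
  ≡⟨ rearrange (+ n) (sign k) (Δ^ k Q (+ 1)) ⟩
    - + n * sign k * (+ 2 * Δ^ k Q (+ 1))
  ≡⟨ cong (- + n * sign k *_) (twice-Δ^-at-1 k _ Q (Δ^-scalingDefect m k) (scalingDefect-neg m n)) ⟩
    - + n * sign k * (+ suc n * (+ (n !) * (m ^ n - m ^ k)))
  ≡⟨ simplify (+ n) (sign k) (+ suc n) (+ (n !)) m (m ^ k) ⟩
    sign k * m ^ k * (+ 1 - m) * + n * (+ suc n * + (n !))
  ≡⟨ cong (sign k * m ^ k * (+ 1 - m) * + n *_) (sym (ℤ.pos-* (suc n) (n !))) ⟩
    sign k * m ^ k * (+ 1 - m) * + n * + (suc n !)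
  ∎
  where
  open ≡-Reasoning
  n : ℕ
  n = suc k
  Q : ℤ → ℤ
  Q = scalingDefect m n
  rearrange : ∀ (n s x : ℤ) → + 2 * (- n * (s * x)) ≡ - n * s * (+ 2 * x)
  rearrange = solve-∀
  simplify : ∀ (n s n+1 n! m mᵏ : ℤ) →
    - n * s * (n+1 * (n! * (m * mᵏ - mᵏ))) ≡ s * mᵏ * (+ 1 - m) * n * (n+1 * n!)
  simplify = solve-∀

proposition4p2 : (n : ℕ) → n ≥ 1 → (m : ℤ) →
    (sumTo n (λ l → sign l * + (n C l) * F (+ l + m - + n + + 1) (ℕ.suc n))
       ≡ sign n * + (n !))
    ×
    (+ 2 * sumFrom1 n (λ l → sign l * + (n C l) * + l
              * (F (+ l * m) (ℕ.suc n) - m ^ (n ∸ 1) * F (+ l) (ℕ.suc n)))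
       ≡ sign (n ∸ 1) * m ^ (n ∸ 1) * (+ 1 - m) * + n * + ((ℕ.suc n) !))
proposition4p2 n@(suc k) (s≤s z≤n) m = first-identity n m , second-identity k m
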